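{- Let $\psi(x)$ be a formula with a single free variable and no parameters and let $r\subseteq\omega$. If $(S^r_\psi(M),\vartriangleleft)$ is well-founded for every set $M\supseteq\omega\cup\{r\}$, then the class $(S^r_\psi(\mathbb V),\vartriangleleft)$ is well-founded, i.e. every non-empty set $z\subseteq S^r_\psi(\mathbb V)$ has a $\vartriangleleft$-minimal element.
   Context: $\sigma\vartriangleleft\tau$ means the finite sequence $\sigma$ is a proper end-extension of $\tau$. For a set $M\supseteq\omega\cup\{r\}$, the tree $S^r_\psi(M)\subseteq M^{<\omega}$ with labelling $l_M$ (into finite sequences of closed negation-normal-form set-theoretic formulas with parameters from $M$) is defined by recursion: $\langle\rangle\in S^r_\psi(M)$, $l_M(\langle\rangle)=\langle\neg\psi(r),\neg\forall_{x,y}(\forall_z(z\in x\leftrightarrow z\in y)\to x=y)\rangle$; $\sigma^\frown a$ can be in the tree only if $\sigma$ is. For $\sigma\in S^r_\psi(M)$ with $l_M(\sigma)=\varphi,\Gamma$: if $\varphi$ is a true literal, $\sigma$ is a leaf; if $\varphi$ is a false literal, $\sigma^\frown a\in S^r_\psi(M)$ iff $a=0$, $l_M(\sigma^\frown0)=\Gamma,\varphi$; if $\varphi\equiv\varphi_0\land\varphi_1$, $\sigma^\frown a\in S^r_\psi(M)$ iff $a\in\{0,1\}$, $l_M(\sigma^\frown a)=\Gamma,\varphi,\varphi_a$; if $\varphi\equiv\varphi_0\lor\varphi_1$, $\sigma^\frown a\in S^r_\psi(M)$ iff $a=0$, $l_M(\sigma^\frown0)=\Gamma,\varphi,\varphi_0,\varphi_1$;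 if $\varphi\equiv\forall_x\theta(x)$, $\sigma^\frown a\in S^r_\psi(M)$ iff $a\in M$, $l_M(\sigma^\frown a)=\Gamma,\varphi,\theta(a)$; if $\varphi\equiv\exists_x\theta(x)$ and $\sigma=\langle\sigma_0,\dots,\sigma_{n-1}\rangle$, let $b$ be the first entry of $r,\sigma_0,0,\sigma_1,1,\dots,\sigma_{n-1},n-1,n,n+1,\dots$ such that $\theta(b)$ does not occur in $\Gamma$; then $\sigma^\frown a\in S^r_\psi(M)$ iff $a=0$, $l_M(\sigma^\frown0)=\Gamma,\varphi,\theta(b)$. For an arbitrary finite sequence of sets $\sigma=\langle\sigma_0,\dots,\sigma_{n-1}\rangle$ put $M_\sigma:=\{\sigma_0,\dots,\sigma_{n-1}\}\cup\omega\cup\{r\}$, and define the class $S^r_\psi(\mathbb V):=\{\sigma\in\mathbb V^{<\omega}\mid\sigma\in S^r_\psi(M_\sigma)\}$. -}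

module Defs where

open import Data.Nat using (ℕ; zero; suc; _+_; _<_)
open import Data.Fin using (Fin; zero; suc)
open import Data.List using (List; []; _∷_; _++_; length; lookup)
open import Data.List.Relation.Unary.Any using (Any)
open import Data.Product using (Σ; _×_; _,_)
open import Data.Sum using (_⊎_; inj₁; inj₂; [_,_])
open import Data.Empty using (⊥; ⊥-elim)
open import Data.Unit using (⊤; tt)
open import Relation.Nullary using (¬_)
open import Relation.Binary.PropositionalEquality using (_≡_)

-- The set-theoretic universe: Aczel's iterative sets (well-founded trees),
-- with extensional equality ≈ (bisimulation) and membership ∈ up to ≈.

data V : Set₁ where
  sup : (I : Set) → (I → V) → V

_≈_ : V → V → Set
sup I f ≈ sup J g =
  ((i : I) → Σ J (λ j → f i ≈ g j)) × ((j : J) → Σ I (λ i → f i ≈ g j))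

_∈_ : V → V → Set
x ∈ sup J g = Σ J (λ j → x ≈ g j)

∅ : V
∅ = sup ⊥ ⊥-elim

｛_｝ : V → V
｛ x ｝ = sup ⊤ (λ _ → x)

_∪_ : V → V → V
sup I f ∪ sup J g = sup (I ⊎ J) [ f , g ]

numeral : ℕ → V
numeral zero    = ∅
numeral (suc n) = numeral n ∪ ｛ numeral n ｝

ωV : V
ωV = sup ℕ numeral

entries : List V → V
entries σ = sup (Fin (length σ)) (lookup σ)

-- Negation-normal-form formulas with de Bruijn variables (variable 0 is
-- bound by the innermost quantifier) and parameters from P.

Tm : ∀ {ℓ} → Set ℓ → ℕ → Set ℓ
Tm P n = Fin n ⊎ P

data Fm {ℓ} (P : Set ℓ) : ℕ → Set ℓ where
  _∈'_ _∉'_ _≐_ _≠_ : ∀ {n} → Tm P n → Tm P n → Fm P n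
  _∧'_ _∨'_          : ∀ {n} → Fm P n → Fm P n → Fm P n
  ∀' ∃'              : ∀ {n} → Fm P (suc n) → Fm P n

mapTm : ∀ {a b} {P : Set a} {Q : Set b} {n} → (P → Q) → Tm P n → Tm Q n
mapTm h (inj₁ i) = inj₁ i
mapTm h (inj₂ p) = inj₂ (h p)

mapFm : ∀ {a b} {P : Set a} {Q : Set b} {n} → (P → Q) → Fm P n → Fm Q n
mapFm h (s ∈' t) = mapTm h s ∈' mapTm h t
mapFm h (s ∉' t) = mapTm h s ∉' mapTm h t
mapFm h (s ≐ t)  = mapTm h s ≐ mapTm h t
mapFm h (s ≠ t)  = mapTm h s ≠ mapTm h t
mapFm h (φ ∧' ψ) = mapFm h φ ∧' mapFm h ψ
mapFm h (φ ∨' ψ) = mapFm h φ ∨' mapFm h ψ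
mapFm h (∀' φ)   = ∀' (mapFm h φ)
mapFm h (∃' φ)   = ∃' (mapFm h φ)

wkTm : ∀ {ℓ} {P : Set ℓ} {m} → Tm P m → Tm P (suc m)
wkTm (inj₁ i) = inj₁ (suc i)
wkTm (inj₂ p) = inj₂ p

ext : ∀ {ℓ} {P : Set ℓ} {n m} → (Fin n → Tm P m) → Fin (suc n) → Tm P (suc m)
ext s zero    = inj₁ zero
ext s (suc i) = wkTm (s i)

subTm : ∀ {ℓ} {P : Set ℓ} {n m} → (Fin n → Tm P m) → Tm P n → Tm P m
subTm s (inj₁ i) = s i
subTm s (inj₂ p) = inj₂ p

subFm : ∀ {ℓ} {P : Set ℓ} {n m} → (Fin n → Tm P m) → Fm P n → Fm P m
subFm s (a ∈' b) = subTm s a ∈' subTm s b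
subFm s (a ∉' b) = subTm s a ∉' subTm s b
subFm s (a ≐ b)  = subTm s a ≐ subTm s b
subFm s (a ≠ b)  = subTm s a ≠ subTm s b
subFm s (φ ∧' ψ) = subFm s φ ∧' subFm s ψ
subFm s (φ ∨' ψ) = subFm s φ ∨' subFm s ψ
subFm s (∀' φ)   = ∀' (subFm (ext s) φ)
subFm s (∃' φ)   = ∃' (subFm (ext s) φ)

inst : ∀ {ℓ} {P : Set ℓ} → Fm P 1 → P → Fm P 0
inst θ b = subFm (λ _ → inj₂ b) θ

neg : ∀ {ℓ} {P : Set ℓ} {n} → Fm P n → Fm P n
neg (a ∈' b) = a ∉' b
neg (a ∉' b) = a ∈' b
neg (a ≐ b)  = a ≠ b
neg (a ≠ b)  = a ≐ b
neg (φ ∧' ψ) = neg φ ∨' neg ψ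
neg (φ ∨' ψ) = neg φ ∧' neg ψ
neg (∀' φ)   = ∃' (neg φ)
neg (∃' φ)   = ∀' (neg φ)

-- ¬∀x,y(∀z(z∈x ↔ z∈y) → x = y) in negation normal form:
-- ∃x ∃y (∀z ((z∉x ∨ z∈y) ∧ (z∉y ∨ z∈x)) ∧ x ≠ y)
negExt : ∀ {ℓ} {P : Set ℓ} → Fm P 0
negExt = ∃' (∃' (∀' (((z ∉' x) ∨' (z ∈' y)) ∧' ((z ∉' y) ∨' (z ∈' x)))
                 ∧' (inj₁ (suc zero) ≠ inj₁ zero)))
  where
  z = inj₁ zero
  y = inj₁ (suc zero)
  x = inj₁ (suc (suc zero))

val : Tm V 0 → V
val (inj₁ ())
val (inj₂ x) = x

data Literal : Fm V 0 → Set₁ where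
  lit∈ : ∀ a b → Literal (a ∈' b)
  lit∉ : ∀ a b → Literal (a ∉' b)
  lit≐ : ∀ a b → Literal (a ≐ b)
  lit≠ : ∀ a b → Literal (a ≠ b)

-- truth of a closed formula (used only for literals)
TrueLit : Fm V 0 → Set
TrueLit (a ∈' b) = val a ∈ val b
TrueLit (a ∉' b) = ¬ (val a ∈ val b)
TrueLit (a ≐ b)  = val a ≈ val b
TrueLit (a ≠ b)  = ¬ (val a ≈ val b)
TrueLit _        = ⊥

_≈T_ : ∀ {n} → Tm V n → Tm V n → Set
inj₁ i ≈T inj₁ j = i ≡ j
inj₂ x ≈T inj₂ y = x ≈ y
_      ≈T _      = ⊥

_≈F_ : ∀ {n} → Fm V n → Fm V n → Set
(a ∈' b) ≈F (c ∈' d) = (a ≈T c) × (b ≈T d)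
(a ∉' b) ≈F (c ∉' d) = (a ≈T c) × (b ≈T d)
(a ≐ b)  ≈F (c ≐ d)  = (a ≈T c) × (b ≈T d)
(a ≠ b)  ≈F (c ≠ d)  = (a ≈T c) × (b ≈T d)
(φ ∧' ψ) ≈F (χ ∧' ξ) = (φ ≈F χ) × (ψ ≈F ξ)
(φ ∨' ψ) ≈F (χ ∨' ξ) = (φ ≈F χ) × (ψ ≈F ξ)
∀' φ     ≈F ∀' χ     = φ ≈F χ
∃' φ     ≈F ∃' χ     = φ ≈F χ
_        ≈F _        = ⊥

Occurs : Fm V 0 → List (Fm V 0) → Set₁
Occurs φ Γ = Any (λ χ → χ ≈F φ) Γ

-- Candidate witnesses for the ∃-rule:
-- r, σ₀, 0, σ₁, 1, …, σ_{n-1}, n-1, n, n+1, …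

interleave : ℕ → List V → List V
interleave i []       = []
interleave i (x ∷ xs) = x ∷ numeral i ∷ interleave (suc i) xs

ent : List V → (ℕ → V) → ℕ → V
ent []       t k       = t k
ent (x ∷ xs) t zero    = x
ent (x ∷ xs) t (suc k) = ent xs t k

witness : V → List V → ℕ → V
witness r σ = ent (r ∷ interleave 0 σ) (λ j → numeral (length σ + j))

-- The tree S^r_ψ(M) with its labelling, as an inductive relation
-- Node r ψ M σ Γ  :  "σ ∈ S^r_ψ(M) and l_M(σ) = Γ".
-- Labels are lists φ ∷ Γ, whose head is the formula φ being treated;
-- appending at the end (Γ,φ,…) is _++_.

module Tree (r : V) (ψ : Fm ⊥ 1) (M : V) where

  ψr : Fm V 0
  ψr = inst (mapFm ⊥-elim ψ) r

  data Node : List V → List (Fm V 0) → Set₁ where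
    root   : Node [] (neg ψr ∷ negExt ∷ [])
    falseL : ∀ {σ φ Γ} a → Node σ (φ ∷ Γ) → Literal φ → ¬ TrueLit φ →
             a ≈ numeral 0 → Node (σ ++ a ∷ []) (Γ ++ φ ∷ [])
    and₀   : ∀ {σ φ₀ φ₁ Γ} a → Node σ ((φ₀ ∧' φ₁) ∷ Γ) → a ≈ numeral 0 →
             Node (σ ++ a ∷ []) (Γ ++ (φ₀ ∧' φ₁) ∷ φ₀ ∷ [])
    and₁   : ∀ {σ φ₀ φ₁ Γ} a → Node σ ((φ₀ ∧' φ₁) ∷ Γ) → a ≈ numeral 1 →
             Node (σ ++ a ∷ []) (Γ ++ (φ₀ ∧' φ₁) ∷ φ₁ ∷ [])
    or     : ∀ {σ φ₀ φ₁ Γ} a → Node σ ((φ₀ ∨' φ₁) ∷ Γ) → a ≈ numeral 0 →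
             Node (σ ++ a ∷ []) (Γ ++ (φ₀ ∨' φ₁) ∷ φ₀ ∷ φ₁ ∷ [])
    all    : ∀ {σ θ Γ} a → Node σ (∀' θ ∷ Γ) → a ∈ M →
             Node (σ ++ a ∷ []) (Γ ++ ∀' θ ∷ inst θ a ∷ [])
    ex     : ∀ {σ θ Γ} a (k : ℕ) → Node σ (∃' θ ∷ Γ) →
             ((k' : ℕ) → k' < k → Occurs (inst θ (witness r σ k')) Γ) →
             ¬ Occurs (inst θ (witness r σ k)) Γ →
             a ≈ numeral 0 →
             Node (σ ++ a ∷ []) (Γ ++ ∃' θ ∷ inst θ (witness r σ k) ∷ [])

InS : V → Fm ⊥ 1 → V → List V → Set₁
InS r ψ M σ = Σ (List (Fm V 0)) (Tree.Node r ψ M σ)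

Mσ : V → List V → V
Mσ r σ = entries σ ∪ (ωV ∪ ｛ r ｝)

InSV : V → Fm ⊥ 1 → List V → Set₁
InSV r ψ σ = InS r ψ (Mσ r σ) σ

_≈L_ : List V → List V → Set
[]       ≈L []       = ⊤
(x ∷ xs) ≈L (y ∷ ys) = (x ≈ y) × (xs ≈L ys)
_        ≈L _        = ⊥

_◁_ : List V → List V → Set₁
σ ◁ τ = Σ V (λ a → Σ (List V) (λ ρ → σ ≈L (τ ++ a ∷ ρ)))

_⊆V_ : V → V → Set₁
A ⊆V B = (x : V) → x ∈ A → x ∈ B

-- A set z of finite sequences is given as a family z : I → List V indexed
-- by a small type I (as for elements of V); it is non-empty iff I is
-- inhabited; u ∈ z iff u ≈L z i for some i.
-- "Every non-empty set z ⊆ S has a ◁-minimal element", for S ⊆ V^{<ω}: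
WellFoundedOn : (List V → Set₁) → Set₁
WellFoundedOn S =
  (I : Set) (z : I → List V) → I → ((i : I) → S (z i)) →
  Σ I (λ i → ¬ Σ I (λ j → z j ◁ z i))

module Submission where

-- The class S^r_ψ(𝕍) is glued together from the set-sized
-- trees S^r_ψ(M_σ), so a set z ⊆ S^r_ψ(𝕍) already lives inside a single
-- tree: put  M_z := (⋃_{σ ∈ z} {σ₀,…,σ_{n-1}}) ∪ ω ∪ {r}.
--   * M_σ ⊆ M_z for every σ ∈ z (bookkeeping with unions of sets);
--   * S^r_ψ(M) is monotone in M: the defining rules only consult M in the
--     ∀-rule, through the side condition a ∈ M;
--   * hence z ⊆ S^r_ψ(M_z), and M_z ⊇ ω ∪ {r}, so the well-foundedness
--     hypothesis for the set M_z yields a ◁-minimal element of z.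

open import Defs
open import Data.Empty using (⊥)
open import Data.Unit using (tt)
open import Data.Fin using (Fin)
open import Data.List using (List; length; lookup)
open import Data.Product using (Σ; _,_; proj₁; proj₂)
open import Data.Sum using (inj₁; inj₂)

≈-refl : (x : V) → x ≈ x
≈-refl (sup I f) = (λ i → i , ≈-refl (f i)) , (λ j → j , ≈-refl (f j))

⊆-∪ˡ : (A B : V) → A ⊆V (A ∪ B)
⊆-∪ˡ (sup I f) (sup J g) x (i , x≈fi) = inj₁ i , x≈fi

⊆-∪ʳ : (A B : V) → B ⊆V (A ∪ B)
⊆-∪ʳ (sup I f) (sup J g) x (j , x≈gj) = inj₂ j , x≈gj

∪-monoˡ : (A A' B : V) → A ⊆V A' → (A ∪ B) ⊆V (A' ∪ B)
∪-monoˡ (sup I f) A' (sup J g) A⊆A' x (inj₁ i , x≈fi) =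
  ⊆-∪ˡ A' (sup J g) x (A⊆A' x (i , x≈fi))
∪-monoˡ (sup I f) A' (sup J g) A⊆A' x (inj₂ j , x≈gj) =
  ⊆-∪ʳ A' (sup J g) x (j , x≈gj)

-- S^r_ψ(M) grows with M: only the ∀-rule mentions M, via a ∈ M.
module _ (r : V) (ψ : Fm ⊥ 1) where
  open Tree r ψ

  Node-mono : ∀ {M M'} → M ⊆V M' → ∀ {σ Γ} → Node M σ Γ → Node M' σ Γ
  Node-mono M⊆M' root                  = root
  Node-mono M⊆M' (falseL a n l f e)    = falseL a (Node-mono M⊆M' n) l f e
  Node-mono M⊆M' (and₀ a n e)          = and₀ a (Node-mono M⊆M' n) e
  Node-mono M⊆M' (and₁ a n e)          = and₁ a (Node-mono M⊆M' n) e
  Node-mono M⊆M' (or a n e)            = or a (Node-mono M⊆M' n) e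
  Node-mono M⊆M' (all a n a∈M)         = all a (Node-mono M⊆M' n) (M⊆M' a a∈M)
  Node-mono M⊆M' (ex a k n earlier fresh e) = ex a k (Node-mono M⊆M' n) earlier fresh e

  InS-mono : ∀ {M M'} → M ⊆V M' → ∀ {σ} → InS r ψ M σ → InS r ψ M' σ
  InS-mono M⊆M' (Γ , node) = Γ , Node-mono M⊆M' node

allEntries : (I : Set) → (I → List V) → V
allEntries I z = sup (Σ I (λ i → Fin (length (z i)))) (λ p → lookup (z (proj₁ p)) (proj₂ p))

entries⊆allEntries : (I : Set) (z : I → List V) (i : I) → entries (z i) ⊆V allEntries I z
entries⊆allEntries I z i x (k , x≈zik) = (i , k) , x≈zik

Mz : V → (I : Set) → (I → List V) → V
Mz r I z = allEntries I z ∪ (ωV ∪ ｛ r ｝)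

Mσ⊆Mz : (r : V) (I : Set) (z : I → List V) (i : I) → Mσ r (z i) ⊆V Mz r I z
Mσ⊆Mz r I z i = ∪-monoˡ (entries (z i)) (allEntries I z) (ωV ∪ ｛ r ｝) (entries⊆allEntries I z i)

ω⊆Mz : (r : V) (I : Set) (z : I → List V) → ωV ⊆V Mz r I z
ω⊆Mz r I z x x∈ω =
  ⊆-∪ʳ (allEntries I z) (ωV ∪ ｛ r ｝) x (⊆-∪ˡ ωV ｛ r ｝ x x∈ω)

r∈Mz : (r : V) (I : Set) (z : I → List V) → r ∈ Mz r I z
r∈Mz r I z =
  ⊆-∪ʳ (allEntries I z) (ωV ∪ ｛ r ｝) r (⊆-∪ʳ ωV ｛ r ｝ r (tt , ≈-refl r))

InSV⇒InS-Mz : (ψ : Fm ⊥ 1) (r : V) (I : Set) (z : I → List V) →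
              ((i : I) → InSV r ψ (z i)) → (i : I) → InS r ψ (Mz r I z) (z i)
InSV⇒InS-Mz ψ r I z z⊆S i = InS-mono r ψ (Mσ⊆Mz r I z i) (z⊆S i)

lemma3p3 : (ψ : Fm ⊥ 1) (r : V) → r ⊆V ωV →
    ((M : V) → ωV ⊆V M → r ∈ M → WellFoundedOn (InS r ψ M)) →
    WellFoundedOn (InSV r ψ)
lemma3p3 ψ r _ wf I z i₀ z⊆S =
  wf (Mz r I z) (ω⊆Mz r I z) (r∈Mz r I z) I z i₀ (InSV⇒InS-Mz ψ r I z z⊆S)
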